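{- Let $P=(I,J,\emptyset)$ be a reduced presentation and let $\mathcal Q=\mathcal Q[I,J]$. If $I{\downarrow}\cap J{\downarrow}\supsetneq\{1\}$, then $\mathcal Q$ is not primitive.
   Context: A Wajsberg hoop is a commutative integral residuated lattice $\langle A,\vee,\wedge,\cdot,\rightarrow,1\rangle$ satisfying $(x\rightarrow y)\vee(y\rightarrow x)\approx1$, $x(x\rightarrow y)\approx y(y\rightarrow x)$ and $(x\rightarrow y)\rightarrow y\approx(y\rightarrow x)\rightarrow x$. For a totally ordered abelian group $\mathbf G$ with strong unit $u>0$, $\Gamma(\mathbf G,u)$ is the Wajsberg hoop on $\{a\in G:0\le a\le u\}$ with $a\cdot b=\max\{a+b-u,0\}$, $a\rightarrow b=\min\{u-a+b,u\}$, top $u$. $\mathbb Z\times_l\mathbb Z$ is the lexicographic product of two copies of $\mathbb Z$ (first coordinate dominant). $\mathbf{Ł}_n=\Gamma(\mathbb Z,n)$, $\mathbf{Ł}_{n,k}=\Gamma(\mathbb Z\times_l\mathbb Z,(n,k))$. A reduced presentation with $K=\emptyset$ is $(I,J,\emptyset)$ where $I,J$ are finite sets of positive integers, $I\cup J\ne\emptyset$, no $m\in I$ divides any element of $(I\setminus\{m\})\cup J$, and no $n\in J$ divides any element of $J\setminus\{n\}$. $X{\downarrow}$ denotes the set of divisors of elements of $X$. $\mathcal Q[I,J]$ is the quasivariety generated by $\{\mathbf{Ł}_i:i\in I\}\cup\{\mathbf{Ł}_{j,1}:j\in J\}$. A quasivariety $\mathcal Q$ is primitive if every subquasivariety $\mathcal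 Q'$ of $\mathcal Q$ satisfies $\mathcal Q'=\mathbf H(\mathcal Q')\cap\mathcal Q$, $\mathbf H$ denoting closure under homomorphic images. -}

module Defs where

open import Level using (Level; suc; zero) renaming (_⊔_ to _⊔ℓ_)
open import Data.Bool using (Bool; true; false; if_then_else_; _∧_; _∨_; not)
open import Data.Nat as ℕ using (ℕ; _∸_; _⊓_; _⊔_; s≤s)
open import Data.Nat.Divisibility using (_∣_)
open import Data.Nat.Properties using (m⊓n≤n; <-cmp)
open import Data.Integer as ℤ using (ℤ; +_; -[1+_]; _≤ᵇ_)
open import Data.Fin using (Fin; toℕ; fromℕ<)
open import Data.Product using (Σ; ∃; _×_; _,_; proj₁; proj₂)
open import Data.List using (List)
open import Data.List.Relation.Unary.All using (All)
open import Data.List.Membership.Propositional using (_∈_)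
open import Relation.Binary.PropositionalEquality using (_≡_; _≢_)
open import Relation.Binary.Definitions using (tri<; tri≈; tri>)
open import Relation.Nullary using (¬_)

record Alg : Set₁ where
  field
    Carrier : Set
    join meet mul imp : Carrier → Carrier → Carrier
    one : Carrier

open Alg public

data Term : Set where
  var : ℕ → Term
  `1  : Term
  _`∨_ _`∧_ _`·_ _`→_ : Term → Term → Term

⟦_⟧ : Term → (A : Alg) → (ℕ → Carrier A) → Carrier A
⟦ var x ⟧   A ρ = ρ x
⟦ `1 ⟧      A ρ = one A
⟦ s `∨ t ⟧  A ρ = join A (⟦ s ⟧ A ρ) (⟦ t ⟧ A ρ)
⟦ s `∧ t ⟧  A ρ = meet A (⟦ s ⟧ A ρ) (⟦ t ⟧ A ρ)
⟦ s `· t ⟧  A ρ = mul  A (⟦ s ⟧ A ρ) (⟦ t ⟧ A ρ)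
⟦ s `→ t ⟧  A ρ = imp  A (⟦ s ⟧ A ρ) (⟦ t ⟧ A ρ)

Eqn : Set
Eqn = Term × Term

record QI : Set where
  constructor _⇒_
  field
    premises   : List Eqn
    conclusion : Eqn

HoldsAt : (A : Alg) → (ℕ → Carrier A) → Eqn → Set
HoldsAt A ρ (s , t) = ⟦ s ⟧ A ρ ≡ ⟦ t ⟧ A ρ

_⊨_ : Alg → QI → Set
A ⊨ (ps ⇒ c) = (ρ : ℕ → Carrier A) → All (HoldsAt A ρ) ps → HoldsAt A ρ c

Mod : (QI → Set) → Alg → Set
Mod Σ A = ∀ q → Σ q → A ⊨ q

record SurjHom (A B : Alg) : Set where
  field
    f      : Carrier A → Carrier B
    f-join : ∀ x y → f (join A x y) ≡ join B (f x) (f y)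
    f-meet : ∀ x y → f (meet A x y) ≡ meet B (f x) (f y)
    f-mul  : ∀ x y → f (mul A x y) ≡ mul B (f x) (f y)
    f-imp  : ∀ x y → f (imp A x y) ≡ imp B (f x) (f y)
    f-one  : f (one A) ≡ one B
    f-surj : ∀ b → ∃ λ a → f a ≡ b

H : (Alg → Set) → Alg → Set₁
H K B = Σ Alg λ A → K A × SurjHom A B

-- 𝒬 (given as a class) is primitive: every subquasivariety 𝒬' = Mod Σ' ⊆ 𝒬
-- satisfies 𝒬' = 𝐇(𝒬') ∩ 𝒬.
Primitive : (Alg → Set) → Set₁
Primitive Q =
  (Σ' : QI → Set) → (∀ A → Mod Σ' A → Q A) →
    ((∀ B → Mod Σ' B → H (Mod Σ') B × Q B) ×
     (∀ B → H (Mod Σ') B → Q B → Mod Σ' B))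

-- Ł_n = Γ(ℤ, n) : carrier {0,…,n} = Fin (suc n)
-- (finℓ only serves typing: all results below already lie in [0,n])

finℓ : (n : ℕ) → ℕ → Fin (ℕ.suc n)
finℓ n x = fromℕ< (s≤s (m⊓n≤n x n))

Ł : ℕ → Alg
Ł n = record
  { Carrier = Fin (ℕ.suc n)
  ; join = λ a b → finℓ n (toℕ a ⊔ toℕ b)
  ; meet = λ a b → finℓ n (toℕ a ⊓ toℕ b)
  ; mul  = λ a b → finℓ n ((toℕ a ℕ.+ toℕ b) ∸ n)
  ; imp  = λ a b → finℓ n (n ∸ (toℕ a ∸ toℕ b))         -- min{n-a+b,n}
  ; one  = finℓ n n
  }

-- Ł_{n,1} = Γ(ℤ ×ₗ ℤ, (n,1)) for n = suc m.
-- Elements (a,b) with (0,0) ≤ₗ (a,b) ≤ₗ (n,1) are encoded without junk: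
--   bot k   ↦ (0 , k)          k ≥ 0
--   mid i b ↦ (1 + i , b)      0 ≤ i < m, b ∈ ℤ   (so 0 < a < n)
--   top k   ↦ (n , 1 - k)      k ≥ 0

data E (m : ℕ) : Set where
  bot : ℕ → E m
  mid : Fin m → ℤ → E m
  top : ℕ → E m

ℤ² : Set
ℤ² = ℤ × ℤ

toP : ∀ {m} → E m → ℤ²
toP     (bot k)   = (+ 0 , + k)
toP     (mid i b) = (+ ℕ.suc (toℕ i) , b)
toP {m} (top k)   = (+ ℕ.suc m , (+ 1) ℤ.- (+ k))

-- clamp into the interval [(0,0),(n,1)] (lexicographic) and encode
fromP : ∀ {m} → ℤ² → E m
fromP     (-[1+ _ ] , _) = bot 0
fromP     (+ 0 , + k) = bot k
fromP     (+ 0 , -[1+ _ ]) = bot 0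
fromP {m} (+ ℕ.suc a , b) with <-cmp a m
... | tri< p _ _ = mid (fromℕ< p) b
... | tri> _ _ _ = top 0
... | tri≈ _ _ _ with b
...   | + 0 = top 1
...   | + ℕ.suc _ = top 0
...   | -[1+ k ] = top (ℕ.suc (ℕ.suc k))

-- lexicographic order (first coordinate dominant), as a Boolean test
_≤ₗ_ : ℤ² → ℤ² → Bool
(a , b) ≤ₗ (a' , b') = (a ≤ᵇ a') ∧ (not (a' ≤ᵇ a) ∨ (b ≤ᵇ b'))

maxₗ minₗ : ℤ² → ℤ² → ℤ²
maxₗ p q = if p ≤ₗ q then q else p
minₗ p q = if p ≤ₗ q then p else q

_+²_ _-²_ : ℤ² → ℤ² → ℤ²
(a , b) +² (a' , b') = (a ℤ.+ a' , b ℤ.+ b')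
(a , b) -² (a' , b') = (a ℤ.- a' , b ℤ.- b')

-- Ł_{suc m , 1}
Ł1 : ℕ → Alg
Ł1 m = record
  { Carrier = E m
  ; join = λ x y → fromP (maxₗ (toP x) (toP y))
  ; meet = λ x y → fromP (minₗ (toP x) (toP y))
  ; mul  = λ x y → fromP ((toP x +² toP y) -² u)
  ; imp  = λ x y → fromP ((u -² toP x) +² toP y)
  ; one  = top 0
  }
  where
  u : ℤ²
  u = (+ ℕ.suc m , + 1)

-- 𝒬[I,J] : the quasivariety generated by {Ł_i : i ∈ I} ∪ {Ł_{j,1} : j ∈ J},
-- i.e. the models of all quasi-identities valid in every generator.

ValidInGens : List ℕ → List ℕ → QI → Set
ValidInGens I J q =
  (∀ i → i ∈ I → Ł i ⊨ q) × (∀ j m → j ∈ J → j ≡ ℕ.suc m → Ł1 m ⊨ q)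

𝒬 : List ℕ → List ℕ → Alg → Set
𝒬 I J = Mod (ValidInGens I J)

ReducedPresentation : List ℕ → List ℕ → Set
ReducedPresentation I J =
  (∀ i → i ∈ I → 0 ≢ i) ×
  (∀ j → j ∈ J → 0 ≢ j) ×
  ((∃ λ x → x ∈ I) Data.Sum.⊎ (∃ λ x → x ∈ J)) ×
  (∀ m k → m ∈ I → k ∈ I → k ≢ m → ¬ (m ∣ k)) ×
  (∀ m k → m ∈ I → k ∈ J → ¬ (m ∣ k)) ×
  (∀ n k → n ∈ J → k ∈ J → k ≢ n → ¬ (n ∣ k))
  where import Data.Sum

_∈↓_ : ℕ → List ℕ → Set
d ∈↓ X = ∃ λ x → x ∈ X × d ∣ x

CommonDivisorsProper : List ℕ → List ℕ → Set
CommonDivisorsProper I J =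
  (1 ∈↓ I × 1 ∈↓ J) × (∃ λ d → d ≢ 1 × d ∈↓ I × d ∈↓ J)

-- Let d ≥ 2 divide some i ∈ I and some j = t d ∈ J, and let q be the quasi-identity
-- x^(d-1) → x^d ≈ x & x^d ≈ x^(d+1) ⇒ x ≈ 1, which fails in Ł_d at the coatom d - 1.
-- Let A be the subalgebra of Ł_{j,1} of elements whose first coordinate is a multiple
-- of t.  Dividing first coordinates by t maps A onto Ł_d, so a counterexample x in A
-- would have first coordinate j or j - t.  In the first case x^d ≈ x^(d+1) forces x = 1;
-- in the second, x = (j - t , b) and the first premise forces d b = d - 1 in ℤ.  Hence
-- A ⊨ q and A ∈ 𝒬, while Ł_d ∈ 𝒬 as a subalgebra of Ł_i.  So Ł_d ∈ 𝐇(𝒬') ∩ 𝒬 for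
-- the subquasivariety 𝒬' = 𝒬 ∩ Mod {q}, but Ł_d ∉ 𝒬'.

module Submission where

open import Defs
open import Data.Bool using (T; true; false)
open import Data.Unit using (tt)
open import Data.Empty using (⊥-elim)
open import Data.Nat using (ℕ; zero; suc; _∸_; _⊓_; _⊔_; _+_; _*_; _≤_; _<_; s≤s; z≤n; NonZero; >-nonZero⁻¹)
open import Data.Nat.Properties
open import Data.Nat.Divisibility using (_∣_; divides; 0∣⇒≡0)
open import Data.Integer as ℤ using (ℤ; +_; -[1+_]; _⊖_)
import Data.Integer.Properties as ℤP
open import Data.Fin using (Fin; toℕ)
open import Data.Fin.Properties using (toℕ-fromℕ<; toℕ-injective; toℕ<n; toℕ≤pred[n])
open import Data.Product using (Σ; ∃; _,_; proj₁; proj₂)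
open import Data.Sum using (_⊎_; inj₁; inj₂)
open import Data.List using (List; []; _∷_)
open import Data.List.Relation.Unary.All as All using (All; []; _∷_)
open import Data.List.Membership.Propositional using (_∈_)
open import Function using (_∘_)
open import Function.Definitions using (Injective)
open import Relation.Binary.PropositionalEquality
open import Relation.Binary.Definitions using (tri<; tri≈; tri>)
open import Relation.Nullary using (¬_)
import Data.Nat.Tactic.RingSolver as ℕ-Ring
import Data.Integer.Tactic.RingSolver as ℤ-Ring

record Hom (A B : Alg) : Set where
  field
    f      : Carrier A → Carrier B
    f-join : ∀ x y → f (join A x y) ≡ join B (f x) (f y)
    f-meet : ∀ x y → f (meet A x y) ≡ meet B (f x) (f y)
    f-mul  : ∀ x y → f (mul A x y) ≡ mul B (f x) (f y)
    f-imp  : ∀ x y → f (imp A x y) ≡ imp B (f x) (f y)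
    f-one  : f (one A) ≡ one B

  toSurjHom : (∀ b → ∃ λ a → f a ≡ b) → SurjHom A B
  toSurjHom surj = record
    { f = f ; f-join = f-join ; f-meet = f-meet ; f-mul = f-mul ; f-imp = f-imp
    ; f-one = f-one ; f-surj = surj }

module _ {A B : Alg} (h : Hom A B) where
  open Hom h

  ⟦⟧-hom : ∀ t (ρ : ℕ → Carrier A) → ⟦ t ⟧ B (f ∘ ρ) ≡ f (⟦ t ⟧ A ρ)
  ⟦⟧-hom (var x)  ρ = refl
  ⟦⟧-hom `1       ρ = sym f-one
  ⟦⟧-hom (s `∨ t) ρ = trans (cong₂ (join B) (⟦⟧-hom s ρ) (⟦⟧-hom t ρ)) (sym (f-join _ _))
  ⟦⟧-hom (s `∧ t) ρ = trans (cong₂ (meet B) (⟦⟧-hom s ρ) (⟦⟧-hom t ρ)) (sym (f-meet _ _))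
  ⟦⟧-hom (s `· t) ρ = trans (cong₂ (mul B) (⟦⟧-hom s ρ) (⟦⟧-hom t ρ)) (sym (f-mul _ _))
  ⟦⟧-hom (s `→ t) ρ = trans (cong₂ (imp B) (⟦⟧-hom s ρ) (⟦⟧-hom t ρ)) (sym (f-imp _ _))

  HoldsAt-hom : ∀ ρ {e} → HoldsAt A ρ e → HoldsAt B (f ∘ ρ) e
  HoldsAt-hom ρ {s , t} eq = trans (⟦⟧-hom s ρ) (trans (cong f eq) (sym (⟦⟧-hom t ρ)))

  All-HoldsAt-hom : ∀ ρ {ps} → All (HoldsAt A ρ) ps → All (HoldsAt B (f ∘ ρ)) ps
  All-HoldsAt-hom ρ = All.map (λ {e} → HoldsAt-hom ρ {e})

  ⊨-reflect : Injective _≡_ _≡_ f → ∀ q → B ⊨ q → A ⊨ q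
  ⊨-reflect inj (ps ⇒ (s , t)) B⊨q ρ hs = inj (begin
    f (⟦ s ⟧ A ρ)   ≡⟨ ⟦⟧-hom s ρ ⟨
    ⟦ s ⟧ B (f ∘ ρ) ≡⟨ B⊨q (f ∘ ρ) (All-HoldsAt-hom ρ hs) ⟩
    ⟦ t ⟧ B (f ∘ ρ) ≡⟨ ⟦⟧-hom t ρ ⟩
    f (⟦ t ⟧ A ρ)   ∎)
    where open ≡-Reasoning

  Mod-reflect : Injective _≡_ _≡_ f → ∀ Φ → Mod Φ B → Mod Φ A
  Mod-reflect inj Φ B∈ q q∈Φ = ⊨-reflect inj q (B∈ q q∈Φ)

-- Mod (Φ ∪ {q}) is a subquasivariety containing A, and B is in its 𝐇-image.
Primitive⇒⊨-preserved : ∀ Φ → Primitive (Mod Φ) → ∀ q {A B} →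
  Mod Φ A → A ⊨ q → SurjHom A B → Mod Φ B → B ⊨ q
Primitive⇒⊨-preserved Φ prim q {A} {B} A∈ A⊨q h B∈ =
  proj₂ (prim Φ' Φ'⊆Φ) B (A , A∈Φ' , h) B∈ q (inj₂ refl)
  where
  Φ' : QI → Set
  Φ' q' = Φ q' ⊎ q' ≡ q
  Φ'⊆Φ : ∀ C → Mod Φ' C → Mod Φ C
  Φ'⊆Φ C C∈ q' q'∈Φ = C∈ q' (inj₁ q'∈Φ)
  A∈Φ' : Mod Φ' A
  A∈Φ' q' (inj₁ q'∈Φ) = A∈ q' q'∈Φ
  A∈Φ' _  (inj₂ refl) = A⊨q

record ŁOp : Set where
  field
    op            : ℕ → ℕ → ℕ → ℕ
    op-≤          : ∀ {n x y} → x ≤ n → y ≤ n → op n x y ≤ n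
    *-distribˡ-op : ∀ r n x y → r * op n x y ≡ op (r * n) (r * x) (r * y)

open ŁOp

joinOp meetOp mulOp impOp : ŁOp
joinOp = record
  { op = λ _ x y → x ⊔ y ; op-≤ = ⊔-lub ; *-distribˡ-op = λ r _ → *-distribˡ-⊔ r }
meetOp = record
  { op = λ _ x y → x ⊓ y ; op-≤ = λ x≤n _ → ≤-trans (m⊓n≤m _ _) x≤n
  ; *-distribˡ-op = λ r _ → *-distribˡ-⊓ r }
mulOp = record
  { op = λ n x y → x + y ∸ n
  ; op-≤ = λ {n} x≤n y≤n → ≤-trans (∸-monoˡ-≤ n (+-mono-≤ x≤n y≤n)) (≤-reflexive (m+n∸n≡m n n))
  ; *-distribˡ-op = λ r n x y →
      trans (*-distribˡ-∸ r (x + y) n) (cong (_∸ r * n) (*-distribˡ-+ r x y)) }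
impOp = record
  { op = λ n x y → n ∸ (x ∸ y)
  ; op-≤ = λ {n} {x} {y} _ _ → m∸n≤m n (x ∸ y)
  ; *-distribˡ-op = λ r n x y →
      trans (*-distribˡ-∸ r n (x ∸ y)) (cong (r * n ∸_) (*-distribˡ-∸ r x y)) }

toℕ-finℓ : ∀ {n x} → x ≤ n → toℕ (finℓ n x) ≡ x
toℕ-finℓ x≤n = trans (toℕ-fromℕ< _) (m≤n⇒m⊓n≡m x≤n)

finℓ-toℕ : ∀ {n} (a : Fin (suc n)) → finℓ n (toℕ a) ≡ a
finℓ-toℕ a = toℕ-injective (toℕ-finℓ (toℕ≤pred[n] a))

toℕ-finℓ-op : (o : ŁOp) → ∀ {n} (a b : Fin (suc n)) →
  toℕ (finℓ n (op o n (toℕ a) (toℕ b))) ≡ op o n (toℕ a) (toℕ b)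
toℕ-finℓ-op o a b = toℕ-finℓ (op-≤ o (toℕ≤pred[n] a) (toℕ≤pred[n] b))

module Scale (d r : ℕ) .{{_ : NonZero r}} where

  scale : Fin (suc d) → Fin (suc (r * d))
  scale a = finℓ (r * d) (r * toℕ a)

  toℕ-scale : ∀ a → toℕ (scale a) ≡ r * toℕ a
  toℕ-scale a = toℕ-finℓ (*-monoʳ-≤ r (toℕ≤pred[n] a))

  scale-op : (o : ŁOp) → ∀ a b →
    scale (finℓ d (op o d (toℕ a) (toℕ b))) ≡
    finℓ (r * d) (op o (r * d) (toℕ (scale a)) (toℕ (scale b)))
  scale-op o a b = toℕ-injective (begin
    toℕ (scale (finℓ d (op o d (toℕ a) (toℕ b))))  ≡⟨ toℕ-scale _ ⟩
    r * toℕ (finℓ d (op o d (toℕ a) (toℕ b)))      ≡⟨ cong (r *_) (toℕ-finℓ-op o a b) ⟩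
    r * op o d (toℕ a) (toℕ b)                      ≡⟨ *-distribˡ-op o r d _ _ ⟩
    op o (r * d) (r * toℕ a) (r * toℕ b)            ≡⟨ cong₂ (op o (r * d)) (toℕ-scale a) (toℕ-scale b) ⟨
    op o (r * d) (toℕ (scale a)) (toℕ (scale b))    ≡⟨ toℕ-finℓ-op o (scale a) (scale b) ⟨
    toℕ (finℓ (r * d) (op o (r * d) (toℕ (scale a)) (toℕ (scale b)))) ∎)
    where open ≡-Reasoning

  scale-hom : Hom (Ł d) (Ł (r * d))
  scale-hom = record
    { f = scale
    ; f-join = scale-op joinOp
    ; f-meet = scale-op meetOp
    ; f-mul = scale-op mulOp
    ; f-imp = scale-op impOp
    ; f-one = toℕ-injective (trans (toℕ-scale _)
        (trans (cong (r *_) (toℕ-finℓ ≤-refl)) (sym (toℕ-finℓ ≤-refl))))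
    }

  scale-injective : Injective _≡_ _≡_ scale
  scale-injective {a} {b} eq = toℕ-injective (*-cancelˡ-≡ _ _ r
    (trans (sym (toℕ-scale a)) (trans (cong toℕ eq) (toℕ-scale b))))

Ł-∈-𝒬 : ∀ {I J i d} → i ∈ I → d ∣ i → 0 ≢ i → 𝒬 I J (Ł d)
Ł-∈-𝒬 _ (divides zero refl) 0≢0 = ⊥-elim (0≢0 refl)
Ł-∈-𝒬 {I} {J} {d = d} i∈I (divides r@(suc _) refl) _ =
  Mod-reflect scale-hom scale-injective (ValidInGens I J) (λ q q∈ → proj₁ q∈ _ i∈I)
  where open Scale d r

x^suc : ℕ → Term
x^suc zero    = var 0
x^suc (suc n) = x^suc n `· var 0

-- x^suc k is x^(k+1), so with d = e + 2 this is  x^(d-1) → x^d ≈ x & x^d ≈ x^(d+1) ⇒ x ≈ 1.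
coatom-qi : ℕ → QI
coatom-qi e =
  ((x^suc e `→ x^suc (suc e) , var 0) ∷ (x^suc (suc e) , x^suc (suc (suc e))) ∷ [])
    ⇒ (var 0 , `1)

[m∸n+o]∸p≡o+m∸[p+n] : ∀ m n o p → o ≤ p → m ∸ n + o ∸ p ≡ o + m ∸ (p + n)
[m∸n+o]∸p≡o+m∸[p+n] m n o p o≤p with ≤-total n m
... | inj₁ n≤m = begin
  m ∸ n + o ∸ p   ≡⟨ cong (_∸ p) (+-∸-comm o n≤m) ⟨
  m + o ∸ n ∸ p   ≡⟨ ∸-+-assoc (m + o) n p ⟩
  m + o ∸ (n + p) ≡⟨ cong₂ _∸_ (+-comm m o) (+-comm n p) ⟩
  o + m ∸ (p + n) ∎
  where open ≡-Reasoning
... | inj₂ m≤n = begin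
  m ∸ n + o ∸ p   ≡⟨ cong (λ z → z + o ∸ p) (m≤n⇒m∸n≡0 m≤n) ⟩
  o ∸ p           ≡⟨ m≤n⇒m∸n≡0 o≤p ⟩
  0               ≡⟨ m≤n⇒m∸n≡0 (+-mono-≤ o≤p m≤n) ⟨
  o + m ∸ (p + n) ∎
  where open ≡-Reasoning

toℕ-x^suc-Ł : ∀ n (ρ : ℕ → Fin (suc n)) k →
  toℕ (⟦ x^suc k ⟧ (Ł n) ρ) ≡ suc k * toℕ (ρ 0) ∸ k * n
toℕ-x^suc-Ł n ρ zero    = sym (+-identityʳ _)
toℕ-x^suc-Ł n ρ (suc k) = begin
  toℕ (⟦ x^suc (suc k) ⟧ (Ł n) ρ)    ≡⟨ toℕ-finℓ-op mulOp (⟦ x^suc k ⟧ (Ł n) ρ) (ρ 0) ⟩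
  toℕ (⟦ x^suc k ⟧ (Ł n) ρ) + a ∸ n  ≡⟨ cong (λ z → z + a ∸ n) (toℕ-x^suc-Ł n ρ k) ⟩
  suc k * a ∸ k * n + a ∸ n          ≡⟨ [m∸n+o]∸p≡o+m∸[p+n] _ _ a n (toℕ≤pred[n] (ρ 0)) ⟩
  suc (suc k) * a ∸ suc k * n        ∎
  where
  open ≡-Reasoning
  a = toℕ (ρ 0)

Ł-refutes-coatom-qi : ∀ e → ¬ Ł (2 + e) ⊨ coatom-qi e
Ł-refutes-coatom-qi e Ł⊨q = <⇒≢ ≤-refl (begin
  suc e             ≡⟨ toℕ-c ⟨
  toℕ c             ≡⟨ cong toℕ (Ł⊨q ρ (premise₁ ∷ premise₂ ∷ [])) ⟩
  toℕ (finℓ d d)    ≡⟨ toℕ-finℓ ≤-refl ⟩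
  d                 ∎)
  where
  open ≡-Reasoning
  d = 2 + e
  c = finℓ d (suc e)
  toℕ-c : toℕ c ≡ suc e
  toℕ-c = toℕ-finℓ (n≤1+n _)
  ρ : ℕ → Fin (suc d)
  ρ _ = c
  X : ℕ → Fin (suc d)
  X k = ⟦ x^suc k ⟧ (Ł d) ρ
  P : ℕ → ℕ
  P k = toℕ (X k)
  P-formula : ∀ k → P k ≡ suc k * suc e ∸ k * d
  P-formula k = trans (toℕ-x^suc-Ł d ρ k) (cong (λ z → suc k * z ∸ k * d) toℕ-c)
  square₁ : ∀ e → suc e * suc e ≡ 1 + e * suc (suc e)
  square₁ = ℕ-Ring.solve-∀
  square₂ : ∀ e → suc (suc e) * suc (suc e) ≡ 1 + suc (suc (suc e)) * suc e
  square₂ = ℕ-Ring.solve-∀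
  P₁ : P e ≡ 1
  P₁ = trans (P-formula e) (trans (cong (_∸ e * d) (square₁ e)) (m+n∸n≡m 1 (e * d)))
  P₂ : P (suc e) ≡ 0
  P₂ = trans (P-formula (suc e)) (m≤n⇒m∸n≡0 (≤-reflexive (*-comm d (suc e))))
  P₃ : P (suc (suc e)) ≡ 0
  P₃ = trans (P-formula (suc (suc e)))
    (m≤n⇒m∸n≡0 (≤-trans (n≤1+n _) (≤-reflexive (sym (square₂ e)))))
  premise₁ : HoldsAt (Ł d) ρ (x^suc e `→ x^suc (suc e) , var 0)
  premise₁ = toℕ-injective (begin
    toℕ (imp (Ł d) (X e) (X (suc e)))  ≡⟨ toℕ-finℓ-op impOp (X e) (X (suc e)) ⟩
    d ∸ (P e ∸ P (suc e))              ≡⟨ cong₂ (λ a b → d ∸ (a ∸ b)) P₁ P₂ ⟩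
    suc e                              ≡⟨ toℕ-c ⟨
    toℕ c                              ∎)
  premise₂ : HoldsAt (Ł d) ρ (x^suc (suc e) , x^suc (suc (suc e)))
  premise₂ = toℕ-injective (trans P₂ (sym P₃))

Ł-coatom-qi-premises : ∀ e (ρ : ℕ → Fin (3 + e)) →
  All (HoldsAt (Ł (2 + e)) ρ) (QI.premises (coatom-qi e)) →
  toℕ (ρ 0) ≡ 2 + e ⊎ toℕ (ρ 0) ≡ 1 + e
Ł-coatom-qi-premises e ρ (premise₁ ∷ _) with m≤n⇒m<n∨m≡n (toℕ≤pred[n] (ρ 0))
... | inj₂ a≡2+e = inj₁ a≡2+e
... | inj₁ (s≤s a≤1+e) with m≤n⇒m<n∨m≡n a≤1+e
...   | inj₂ a≡1+e = inj₂ a≡1+e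
...   | inj₁ (s≤s a≤e) = ⊥-elim (<⇒≢ (s≤s (m≤n⇒m≤1+n a≤e)) (sym d≡a))
  where
  d = 2 + e
  X : ℕ → Fin (suc d)
  X k = ⟦ x^suc k ⟧ (Ł d) ρ
  P : ℕ → ℕ
  P k = toℕ (X k)
  P-vanishes : P e ≡ 0
  P-vanishes = trans (toℕ-x^suc-Ł d ρ e) (m≤n⇒m∸n≡0 (begin
    suc e * toℕ (ρ 0) ≤⟨ *-monoʳ-≤ (suc e) a≤e ⟩
    suc e * e         ≡⟨ *-comm (suc e) e ⟩
    e * suc e         ≤⟨ *-monoʳ-≤ e (n≤1+n _) ⟩
    e * d             ∎))
    where open ≤-Reasoning
  d≡a : d ≡ toℕ (ρ 0)
  d≡a = begin
    d                                  ≡⟨ cong (d ∸_) (0∸n≡0 (P (suc e))) ⟨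
    d ∸ (0 ∸ P (suc e))                ≡⟨ cong (λ z → d ∸ (z ∸ P (suc e))) P-vanishes ⟨
    d ∸ (P e ∸ P (suc e))              ≡⟨ toℕ-finℓ-op impOp (X e) (X (suc e)) ⟨
    toℕ (imp (Ł d) (X e) (X (suc e)))  ≡⟨ cong toℕ premise₁ ⟩
    toℕ (ρ 0)                          ∎
    where open ≡-Reasoning

≤ᵇ-true⇒≤ : ∀ {a b} → (a ℤ.≤ᵇ b) ≡ true → a ℤ.≤ b
≤ᵇ-true⇒≤ eq = ℤP.≤ᵇ⇒≤ (subst T (sym eq) tt)

≤ᵇ-false⇒≥ : ∀ {a b} → (a ℤ.≤ᵇ b) ≡ false → b ℤ.≤ a
≤ᵇ-false⇒≥ eq = ℤP.<⇒≤ (ℤP.≰⇒> (λ a≤b → subst T eq (ℤP.≤⇒≤ᵇ a≤b)))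

proj₁-maxₗ : ∀ (P Q : ℤ²) → proj₁ (maxₗ P Q) ≡ proj₁ P ℤ.⊔ proj₁ Q
proj₁-maxₗ (a , b) (a' , b') with a ℤ.≤ᵇ a' in a≤a' | a' ℤ.≤ᵇ a in a'≤a
... | false | _     = sym (ℤP.i≥j⇒i⊔j≡i (≤ᵇ-false⇒≥ a≤a'))
... | true  | false = sym (ℤP.i≤j⇒i⊔j≡j (≤ᵇ-true⇒≤ a≤a'))
... | true  | true with b ℤ.≤ᵇ b'
...   | true  = sym (ℤP.i≤j⇒i⊔j≡j (≤ᵇ-true⇒≤ a≤a'))
...   | false = sym (ℤP.i≥j⇒i⊔j≡i (≤ᵇ-true⇒≤ a'≤a))

proj₁-minₗ : ∀ (P Q : ℤ²) → proj₁ (minₗ P Q) ≡ proj₁ P ℤ.⊓ proj₁ Q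
proj₁-minₗ (a , b) (a' , b') with a ℤ.≤ᵇ a' in a≤a' | a' ℤ.≤ᵇ a in a'≤a
... | false | _     = sym (ℤP.i≥j⇒i⊓j≡j (≤ᵇ-false⇒≥ a≤a'))
... | true  | false = sym (ℤP.i≤j⇒i⊓j≡i (≤ᵇ-true⇒≤ a≤a'))
... | true  | true with b ℤ.≤ᵇ b'
...   | true  = sym (ℤP.i≤j⇒i⊓j≡i (≤ᵇ-true⇒≤ a≤a'))
...   | false = sym (ℤP.i≥j⇒i⊓j≡j (≤ᵇ-true⇒≤ a'≤a))

+m-+n≡+[m∸n] : ∀ {m n} → n ≤ m → + m ℤ.- + n ≡ + (m ∸ n)
+m-+n≡+[m∸n] {m} {n} n≤m = trans (ℤP.m-n≡m⊖n m n) (ℤP.⊖-≥ n≤m)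

+[m+n]-+n≡+m : ∀ m n → + (m + n) ℤ.- + n ≡ + m
+[m+n]-+n≡+m m n = trans (+m-+n≡+[m∸n] (m≤n+m n m)) (cong +_ (m+n∸n≡m m n))

+m-+[m+n]≡-+n : ∀ m n → + m ℤ.- + (m + n) ≡ ℤ.- + n
+m-+[m+n]≡-+n m n = trans (ℤP.m-n≡m⊖n m (m + n))
  (trans (ℤP.⊖-≤ (m≤m+n m n)) (cong (λ k → ℤ.- + k) (m+n∸m≡n m n)))

clamp : ℕ → ℤ → ℕ
clamp n (+ k)      = k ⊓ n
clamp n -[1+ _ ]   = 0

clamp-⊖ : ∀ n k → clamp n (k ⊖ n) ≡ (k ∸ n) ⊓ n
clamp-⊖ n k with ≤-total n k
... | inj₁ n≤k = cong (clamp n) (ℤP.⊖-≥ n≤k)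
... | inj₂ k≤n = trans (cong (clamp n) (ℤP.⊖-≤ k≤n))
    (trans (clamp-neg (n ∸ k)) (cong (_⊓ n) (sym (m≤n⇒m∸n≡0 k≤n))))
  where
  clamp-neg : ∀ l → clamp n (ℤ.- + l) ≡ 0
  clamp-neg zero    = refl
  clamp-neg (suc l) = refl

[m∸n+o]⊓m≡m∸[n∸o] : ∀ m n o → n ≤ m → (m ∸ n + o) ⊓ m ≡ m ∸ (n ∸ o)
[m∸n+o]⊓m≡m∸[n∸o] m n o n≤m with ≤-total o n
... | inj₁ o≤n = trans (m≤n⇒m⊓n≡m (≤-trans (≤-reflexive eq) (m∸n≤m m (n ∸ o)))) eq
  where
  open ≡-Reasoning
  o≤m∸[n∸o] : o ≤ m ∸ (n ∸ o)
  o≤m∸[n∸o] = ≤-trans (≤-reflexive (sym (m∸[m∸n]≡n o≤n))) (∸-monoˡ-≤ (n ∸ o) n≤m)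
  eq : m ∸ n + o ≡ m ∸ (n ∸ o)
  eq = begin
    m ∸ n + o               ≡⟨ cong (λ z → m ∸ z + o) (m∸n+n≡m o≤n) ⟨
    m ∸ (n ∸ o + o) + o     ≡⟨ cong (_+ o) (∸-+-assoc m (n ∸ o) o) ⟨
    m ∸ (n ∸ o) ∸ o + o     ≡⟨ m∸n+n≡m o≤m∸[n∸o] ⟩
    m ∸ (n ∸ o)             ∎
... | inj₂ n≤o = trans (m≥n⇒m⊓n≡n m≤m∸n+o) (sym (cong (m ∸_) (m≤n⇒m∸n≡0 n≤o)))
  where
  m≤m∸n+o : m ≤ m ∸ n + o
  m≤m∸n+o = ≤-trans (≤-reflexive (sym (m∸n+n≡m n≤m))) (+-monoʳ-≤ (m ∸ n) n≤o)

module _ {m : ℕ} where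

  coord₁ : E m → ℕ
  coord₁ (bot _)   = 0
  coord₁ (mid i _) = suc (toℕ i)
  coord₁ (top _)   = suc m

  proj₁-toP : ∀ x → proj₁ (toP x) ≡ + coord₁ x
  proj₁-toP (bot _)   = refl
  proj₁-toP (mid _ _) = refl
  proj₁-toP (top _)   = refl

  coord₁-≤ : ∀ x → coord₁ x ≤ suc m
  coord₁-≤ (bot _)   = z≤n
  coord₁-≤ (mid i _) = s≤s (<⇒≤ (toℕ<n i))
  coord₁-≤ (top _)   = ≤-refl

  coord₁≡suc⇒top : ∀ x → coord₁ x ≡ suc m → ∃ λ s → x ≡ top s
  coord₁≡suc⇒top (mid i _) eq = ⊥-elim (<-irrefl (suc-injective eq) (toℕ<n i))
  coord₁≡suc⇒top (top s)   _  = s , refl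

  coord₁-fromP : ∀ P → coord₁ (fromP {m} P) ≡ clamp (suc m) (proj₁ P)
  coord₁-fromP (-[1+ _ ] , _)   = refl
  coord₁-fromP (+ 0 , + _)      = refl
  coord₁-fromP (+ 0 , -[1+ _ ]) = refl
  coord₁-fromP (+ suc a , b) with <-cmp a m
  ... | tri< a<m _ _ = cong suc (trans (toℕ-fromℕ< _) (sym (m≤n⇒m⊓n≡m (<⇒≤ a<m))))
  ... | tri> _ _ a>m = sym (m≥n⇒m⊓n≡n (s≤s (<⇒≤ a>m)))
  ... | tri≈ _ refl _ with b
  ...   | + 0      = sym (⊓-idem (suc a))
  ...   | + suc _  = sym (⊓-idem (suc a))
  ...   | -[1+ _ ] = sym (⊓-idem (suc a))

  toP-fromP-interior : ∀ {a} b → 0 < a → a < suc m → toP (fromP {m} (+ a , b)) ≡ (+ a , b)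
  toP-fromP-interior {suc a} b _ (s≤s a<m) with <-cmp a m
  ... | tri< p _ _  = cong (λ z → + suc z , b) (toℕ-fromℕ< p)
  ... | tri≈ ¬p _ _ = ⊥-elim (¬p a<m)
  ... | tri> ¬p _ _ = ⊥-elim (¬p a<m)

  fromP-top : ∀ P k → proj₁ P ≡ + suc m → proj₂ P ≡ + 1 ℤ.- + k → fromP {m} P ≡ top k
  fromP-top _ k refl refl with <-cmp m m
  ... | tri< m<m _ _ = ⊥-elim (<-irrefl refl m<m)
  ... | tri> _ _ m>m = ⊥-elim (<-irrefl refl m>m)
  ... | tri≈ _ _ _ with k
  ...   | zero        = refl
  ...   | suc zero    = refl
  ...   | suc (suc _) = refl

  fromP-negative : ∀ P n .{{_ : NonZero n}} → proj₁ P ≡ ℤ.- + n → fromP {m} P ≡ bot 0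
  fromP-negative _ (suc _) refl = refl

  private
    L = Ł1 m
    u : ℤ²
    u = (+ suc m , + 1)

  coord₁-join : ∀ x y → coord₁ (join L x y) ≡ coord₁ x ⊔ coord₁ y
  coord₁-join x y = begin
    coord₁ (join L x y)                      ≡⟨ coord₁-fromP (maxₗ (toP x) (toP y)) ⟩
    clamp (suc m) (proj₁ (maxₗ (toP x) (toP y)))
      ≡⟨ cong (clamp (suc m)) (proj₁-maxₗ (toP x) (toP y)) ⟩
    clamp (suc m) (proj₁ (toP x) ℤ.⊔ proj₁ (toP y))
      ≡⟨ cong₂ (λ a b → clamp (suc m) (a ℤ.⊔ b)) (proj₁-toP x) (proj₁-toP y) ⟩
    (coord₁ x ⊔ coord₁ y) ⊓ suc m
      ≡⟨ m≤n⇒m⊓n≡m (op-≤ joinOp (coord₁-≤ x) (coord₁-≤ y)) ⟩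
    coord₁ x ⊔ coord₁ y                      ∎
    where open ≡-Reasoning

  coord₁-meet : ∀ x y → coord₁ (meet L x y) ≡ coord₁ x ⊓ coord₁ y
  coord₁-meet x y = begin
    coord₁ (meet L x y)                      ≡⟨ coord₁-fromP (minₗ (toP x) (toP y)) ⟩
    clamp (suc m) (proj₁ (minₗ (toP x) (toP y)))
      ≡⟨ cong (clamp (suc m)) (proj₁-minₗ (toP x) (toP y)) ⟩
    clamp (suc m) (proj₁ (toP x) ℤ.⊓ proj₁ (toP y))
      ≡⟨ cong₂ (λ a b → clamp (suc m) (a ℤ.⊓ b)) (proj₁-toP x) (proj₁-toP y) ⟩
    (coord₁ x ⊓ coord₁ y) ⊓ suc m
      ≡⟨ m≤n⇒m⊓n≡m (op-≤ meetOp (coord₁-≤ x) (coord₁-≤ y)) ⟩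
    coord₁ x ⊓ coord₁ y                      ∎
    where open ≡-Reasoning

  coord₁-mul : ∀ x y → coord₁ (mul L x y) ≡ coord₁ x + coord₁ y ∸ suc m
  coord₁-mul x y = begin
    coord₁ (mul L x y)                         ≡⟨ coord₁-fromP ((toP x +² toP y) -² u) ⟩
    clamp (suc m) (proj₁ ((toP x +² toP y) -² u))
      ≡⟨ cong (λ z → clamp (suc m) (z ℤ.- + suc m))
              (cong₂ ℤ._+_ (proj₁-toP x) (proj₁-toP y)) ⟩
    clamp (suc m) (+ (coord₁ x + coord₁ y) ℤ.- + suc m)
      ≡⟨ cong (clamp (suc m)) (ℤP.m-n≡m⊖n (coord₁ x + coord₁ y) (suc m)) ⟩
    clamp (suc m) ((coord₁ x + coord₁ y) ⊖ suc m)
      ≡⟨ clamp-⊖ (suc m) (coord₁ x + coord₁ y) ⟩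
    (coord₁ x + coord₁ y ∸ suc m) ⊓ suc m
      ≡⟨ m≤n⇒m⊓n≡m (op-≤ mulOp (coord₁-≤ x) (coord₁-≤ y)) ⟩
    coord₁ x + coord₁ y ∸ suc m                ∎
    where open ≡-Reasoning

  coord₁-imp : ∀ x y → coord₁ (imp L x y) ≡ suc m ∸ (coord₁ x ∸ coord₁ y)
  coord₁-imp x y = begin
    coord₁ (imp L x y)                         ≡⟨ coord₁-fromP ((u -² toP x) +² toP y) ⟩
    clamp (suc m) (proj₁ ((u -² toP x) +² toP y))
      ≡⟨ cong₂ (λ a b → clamp (suc m) ((+ suc m ℤ.- a) ℤ.+ b)) (proj₁-toP x) (proj₁-toP y) ⟩
    clamp (suc m) ((+ suc m ℤ.- + coord₁ x) ℤ.+ + coord₁ y)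
      ≡⟨ cong (λ z → clamp (suc m) (z ℤ.+ + coord₁ y)) (+m-+n≡+[m∸n] (coord₁-≤ x)) ⟩
    (suc m ∸ coord₁ x + coord₁ y) ⊓ suc m
      ≡⟨ [m∸n+o]⊓m≡m∸[n∸o] (suc m) (coord₁ x) (coord₁ y) (coord₁-≤ x) ⟩
    suc m ∸ (coord₁ x ∸ coord₁ y)              ∎
    where open ≡-Reasoning

  mul-top : ∀ a s → mul L (top a) (top s) ≡ top (s + a)
  mul-top a s = fromP-top _ (s + a) (+[m+n]-+n≡+m (suc m) (suc m)) (top-snd (+ a) (+ s))
    where
    top-snd : ∀ a s → ((+ 1 ℤ.- a) ℤ.+ (+ 1 ℤ.- s)) ℤ.- + 1 ≡ + 1 ℤ.- (s ℤ.+ a)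
    top-snd = ℤ-Ring.solve-∀

  x^suc-top : ∀ (ρ : ℕ → E m) {s} → ρ 0 ≡ top s → ∀ n → ⟦ x^suc n ⟧ L ρ ≡ top (suc n * s)
  x^suc-top ρ {s} x≡top zero    = trans x≡top (cong top (sym (+-identityʳ s)))
  x^suc-top ρ {s} x≡top (suc n) =
    trans (cong₂ (mul L) (x^suc-top ρ x≡top n) x≡top) (mul-top (suc n * s) s)

  coatom-qi-holds-at-top : ∀ e (ρ : ℕ → E m) → coord₁ (ρ 0) ≡ suc m →
    All (HoldsAt L ρ) (QI.premises (coatom-qi e)) → ρ 0 ≡ one L
  coatom-qi-holds-at-top e ρ coord₁≡j (_ ∷ premise₂ ∷ []) with coord₁≡suc⇒top (ρ 0) coord₁≡j
  ... | s , x≡top = trans x≡top (cong top s≡0)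
    where
    open ≡-Reasoning
    top-injective : ∀ {a b} → top {m} a ≡ top b → a ≡ b
    top-injective refl = refl
    s≡0 : s ≡ 0
    s≡0 = sym (+-cancelʳ-≡ (suc (suc e) * s) 0 s (top-injective (begin
      top (suc (suc e) * s)         ≡⟨ x^suc-top ρ x≡top (suc e) ⟨
      ⟦ x^suc (suc e) ⟧ L ρ         ≡⟨ premise₂ ⟩
      ⟦ x^suc (suc (suc e)) ⟧ L ρ   ≡⟨ x^suc-top ρ x≡top (suc (suc e)) ⟩
      top (suc (suc (suc e)) * s)   ∎)))

-- second coordinate of x^(n+1) in Ł_{j,1} for x = (a , b), while no truncation occurs
snd-pow : ℕ → ℤ → ℤ
snd-pow n b = + suc n ℤ.* b ℤ.- + n

snd-pow-zero : ∀ b → snd-pow 0 b ≡ b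
snd-pow-zero b = identity b
  where
  identity : ∀ b → (+ 1 ℤ.+ + 0) ℤ.* b ℤ.- + 0 ≡ b
  identity = ℤ-Ring.solve-∀

snd-pow-suc : ∀ n b → snd-pow n b ℤ.+ b ℤ.- + 1 ≡ snd-pow (suc n) b
snd-pow-suc n b = identity (+ n) b
  where
  identity : ∀ n b → ((+ 1 ℤ.+ n) ℤ.* b ℤ.- n) ℤ.+ b ℤ.- + 1 ≡
                     (+ 1 ℤ.+ (+ 1 ℤ.+ n)) ℤ.* b ℤ.- (+ 1 ℤ.+ n)
  identity = ℤ-Ring.solve-∀

-- The equation reduces to (e + 2) b = e + 1, which has no integer solution.
coatom-snd-absurd : ∀ e b → (+ 1 ℤ.- snd-pow e b) ℤ.+ + 0 ≢ b
coatom-snd-absurd e b eq = no-solution b (ℤP.i-j≡0⇒i≡j _ _ (begin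
  (+ 2 ℤ.+ + e) ℤ.* b ℤ.- (+ 1 ℤ.+ + e)   ≡⟨ rearrange (+ e) b ⟩
  b ℤ.- ((+ 1 ℤ.- snd-pow e b) ℤ.+ + 0)   ≡⟨ cong (λ z → b ℤ.- z) eq ⟩
  b ℤ.- b                                 ≡⟨ ℤP.+-inverseʳ b ⟩
  + 0                                     ∎))
  where
  open ≡-Reasoning
  rearrange : ∀ e b → (+ 2 ℤ.+ e) ℤ.* b ℤ.- (+ 1 ℤ.+ e) ≡
                      b ℤ.- ((+ 1 ℤ.- ((+ 1 ℤ.+ e) ℤ.* b ℤ.- e)) ℤ.+ + 0)
  rearrange = ℤ-Ring.solve-∀
  no-solution : ∀ b → (+ 2 ℤ.+ + e) ℤ.* b ≢ + 1 ℤ.+ + e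
  no-solution (+ zero) eq with trans (sym (ℤP.*-zeroʳ (+ 2 ℤ.+ + e))) eq
  ... | ()
  no-solution (+ suc k) eq = 1+n≰n (≤-trans (m≤m*n (suc (suc e)) (suc k))
    (≤-reflexive (ℤP.+-injective (trans (sym (ℤP.pos-* (suc (suc e)) (suc k))) eq))))
  no-solution -[1+ k ] ()

module Multiples (m e t : ℕ) .{{_ : NonZero t}} (j≡t*d : suc m ≡ t * (2 + e)) where

  private
    L = Ł1 m
    d = 2 + e
    u : ℤ²
    u = (+ suc m , + 1)

  Multiple : E m → Set
  Multiple x = ∃ λ k → coord₁ x ≡ t * k

  lift-op : (o : ŁOp) (_∙_ : E m → E m → E m) →
    (∀ x y → coord₁ (x ∙ y) ≡ op o (suc m) (coord₁ x) (coord₁ y)) →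
    Σ (E m) Multiple → Σ (E m) Multiple → Σ (E m) Multiple
  lift-op o _∙_ coord₁-∙ (x , k , x≡tk) (y , l , y≡tl) = x ∙ y , op o d k l , (begin
    coord₁ (x ∙ y)                      ≡⟨ coord₁-∙ x y ⟩
    op o (suc m) (coord₁ x) (coord₁ y)  ≡⟨ cong₂ (op o (suc m)) x≡tk y≡tl ⟩
    op o (suc m) (t * k) (t * l)        ≡⟨ cong (λ n → op o n (t * k) (t * l)) j≡t*d ⟩
    op o (t * d) (t * k) (t * l)        ≡⟨ *-distribˡ-op o t d k l ⟨
    t * op o d k l                      ∎)
    where open ≡-Reasoning

  A : Alg
  A = record
    { Carrier = Σ (E m) Multiple
    ; join = lift-op joinOp (join L) coord₁-join
    ; meet = lift-op meetOp (meet L) coord₁-meet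
    ; mul  = lift-op mulOp  (mul L)  coord₁-mul
    ; imp  = lift-op impOp  (imp L)  coord₁-imp
    ; one  = top 0 , d , j≡t*d
    }

  proj₁-injective : Injective _≡_ _≡_ (proj₁ {B = Multiple})
  proj₁-injective {x , k , p} {.x , k' , p'} refl with *-cancelˡ-≡ k k' t (trans (sym p) p')
  ... | refl = cong (λ q → x , k , q) (≡-irrelevant p p')

  ⊆-hom : Hom A L
  ⊆-hom = record
    { f = proj₁
    ; f-join = λ _ _ → refl ; f-meet = λ _ _ → refl
    ; f-mul  = λ _ _ → refl ; f-imp  = λ _ _ → refl
    ; f-one  = refl
    }

  A-∈-𝒬 : ∀ {I J} → suc m ∈ J → 𝒬 I J A
  A-∈-𝒬 {I} {J} j∈J = Mod-reflect ⊆-hom proj₁-injective (ValidInGens I J)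
    (λ q q∈ → proj₂ q∈ (suc m) m j∈J refl)

  π : Carrier A → Fin (suc d)
  π (_ , k , _) = finℓ d k

  toℕ-π : ∀ a → toℕ (π a) ≡ proj₁ (proj₂ a)
  toℕ-π (x , k , x≡tk) = toℕ-finℓ (*-cancelˡ-≤ t (begin
    t * k     ≡⟨ x≡tk ⟨
    coord₁ x  ≤⟨ coord₁-≤ x ⟩
    suc m     ≡⟨ j≡t*d ⟩
    t * d     ∎))
    where open ≤-Reasoning

  coord₁≡t*π : ∀ a {k} → toℕ (π a) ≡ k → coord₁ (proj₁ a) ≡ t * k
  coord₁≡t*π a πa≡k = trans (proj₂ (proj₂ a)) (cong (t *_) (trans (sym (toℕ-π a)) πa≡k))

  π-op : (o : ŁOp) (_∙_ : E m → E m → E m) →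
    (coord₁-∙ : ∀ x y → coord₁ (x ∙ y) ≡ op o (suc m) (coord₁ x) (coord₁ y)) → ∀ a b →
    π (lift-op o _∙_ coord₁-∙ a b) ≡ finℓ d (op o d (toℕ (π a)) (toℕ (π b)))
  π-op o _ _ a b = cong (finℓ d) (sym (cong₂ (op o d) (toℕ-π a) (toℕ-π b)))

  π-hom : Hom A (Ł d)
  π-hom = record
    { f = π
    ; f-join = π-op joinOp (join L) coord₁-join
    ; f-meet = π-op meetOp (meet L) coord₁-meet
    ; f-mul  = π-op mulOp  (mul L)  coord₁-mul
    ; f-imp  = π-op impOp  (imp L)  coord₁-imp
    ; f-one  = refl
    }

  π-surjective : ∀ c → ∃ λ a → π a ≡ c
  π-surjective c = (fromP (+ (t * toℕ c) , + 0) , toℕ c , coord₁≡tc) , finℓ-toℕ c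
    where
    coord₁≡tc : coord₁ (fromP {m} (+ (t * toℕ c) , + 0)) ≡ t * toℕ c
    coord₁≡tc = trans (coord₁-fromP (+ (t * toℕ c) , + 0))
      (m≤n⇒m⊓n≡m (≤-trans (*-monoʳ-≤ t (toℕ≤pred[n] c)) (≤-reflexive (sym j≡t*d))))

  private
    c = t * suc e
    j≡c+t : suc m ≡ c + t
    j≡c+t = trans j≡t*d (trans (*-suc t (suc e)) (+-comm t c))
    0<c : 0 < c
    0<c = >-nonZero⁻¹ c {{m*n≢0 t (suc e)}}
    c<j : c < suc m
    c<j = ≤-trans (≤-reflexive (+-comm 1 c))
      (≤-trans (+-monoʳ-≤ c (>-nonZero⁻¹ t)) (≤-reflexive (sym j≡c+t)))

  -- For x = (c , b) with c = j - t, the powers x^(n+1) = (j - (n+1) t , _) stay in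
  -- the middle layer up to x^(d-1) = (t , _); then x^d has first coordinate 0.
  module Interior (ρ : ℕ → E m) (coord₁-x : coord₁ (ρ 0) ≡ c) where

    private
      X : ℕ → E m
      X k = ⟦ x^suc k ⟧ L ρ

    b : ℤ
    b = proj₂ (toP (ρ 0))

    toP-x : toP (ρ 0) ≡ (+ c , b)
    toP-x = cong (_, b) (trans (proj₁-toP (ρ 0)) (cong +_ coord₁-x))

    toP-x^suc : ∀ n r → n + r ≡ e → toP (X n) ≡ (+ (t * suc r) , snd-pow n b)
    toP-x^suc zero    r refl = trans toP-x (cong (_ ,_) (sym (snd-pow-zero b)))
    toP-x^suc (suc n) r n+r≡e = begin
      toP (fromP ((toP (X n) +² toP (ρ 0)) -² u))
        ≡⟨ cong₂ (λ P Q → toP (fromP ((P +² Q) -² u)))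
                 (toP-x^suc n (suc r) (trans (+-suc n r) n+r≡e)) toP-x ⟩
      toP (fromP {m} (+ (t * suc (suc r) + c) ℤ.- + suc m , snd-pow n b ℤ.+ b ℤ.- + 1))
        ≡⟨ cong₂ (λ P Q → toP (fromP {m} (P , Q))) first-coord (snd-pow-suc n b) ⟩
      toP (fromP {m} (+ (t * suc r) , snd-pow (suc n) b))
        ≡⟨ toP-fromP-interior _ (>-nonZero⁻¹ _ {{m*n≢0 t (suc r)}}) t[1+r]<j ⟩
      (+ (t * suc r) , snd-pow (suc n) b) ∎
      where
      open ≡-Reasoning
      shift : ∀ t r c → t * suc (suc r) + c ≡ t * suc r + (c + t)
      shift = ℕ-Ring.solve-∀
      first-coord : + (t * suc (suc r) + c) ℤ.- + suc m ≡ + (t * suc r)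
      first-coord = trans (cong₂ (λ a b → + a ℤ.- + b) (shift t r c) j≡c+t)
                          (+[m+n]-+n≡+m (t * suc r) (c + t))
      t[1+r]<j : t * suc r < suc m
      t[1+r]<j = ≤-<-trans (*-monoʳ-≤ t (s≤s (m+n≤o⇒n≤o (suc n) (≤-reflexive n+r≡e)))) c<j

    toP-x^suc-e : toP (X e) ≡ (+ t , snd-pow e b)
    toP-x^suc-e = trans (toP-x^suc e 0 (+-identityʳ e))
                        (cong (λ k → (+ k , snd-pow e b)) (*-identityʳ t))

    coord₁-x^suc-[1+e] : coord₁ (X (suc e)) ≡ 0
    coord₁-x^suc-[1+e] = begin
      coord₁ (mul L (X e) (ρ 0))          ≡⟨ coord₁-mul (X e) (ρ 0) ⟩
      coord₁ (X e) + coord₁ (ρ 0) ∸ suc m ≡⟨ cong₂ (λ a b → a + b ∸ suc m) coord₁-x^suc-e coord₁-x ⟩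
      t + c ∸ suc m                       ≡⟨ cong (t + c ∸_) j≡c+t ⟩
      t + c ∸ (c + t)                     ≡⟨ m≤n⇒m∸n≡0 (≤-reflexive (+-comm t c)) ⟩
      0                                   ∎
      where
      open ≡-Reasoning
      coord₁-x^suc-e : coord₁ (X e) ≡ t
      coord₁-x^suc-e = ℤP.+-injective (trans (sym (proj₁-toP (X e))) (cong proj₁ toP-x^suc-e))

    x^suc-[1+e]≡bot : All (HoldsAt L ρ) (QI.premises (coatom-qi e)) → X (suc e) ≡ bot 0
    x^suc-[1+e]≡bot (_ ∷ premise₂ ∷ []) = trans premise₂ (fromP-negative _ t (begin
      (proj₁ (toP (X (suc e))) ℤ.+ proj₁ (toP (ρ 0))) ℤ.- + suc m
        ≡⟨ cong₂ (λ a b → (a ℤ.+ b) ℤ.- + suc m)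
                 (trans (proj₁-toP (X (suc e))) (cong +_ coord₁-x^suc-[1+e])) (cong proj₁ toP-x) ⟩
      + c ℤ.- + suc m    ≡⟨ cong (λ k → + c ℤ.- + k) j≡c+t ⟩
      + c ℤ.- + (c + t)  ≡⟨ +m-+[m+n]≡-+n c t ⟩
      ℤ.- + t            ∎))
      where open ≡-Reasoning

    toP-x^suc-e→bot : toP (imp L (X e) (bot 0)) ≡ (+ c , (+ 1 ℤ.- snd-pow e b) ℤ.+ + 0)
    toP-x^suc-e→bot = begin
      toP (fromP ((u -² toP (X e)) +² (+ 0 , + 0)))
        ≡⟨ cong (λ P → toP (fromP ((u -² P) +² (+ 0 , + 0)))) toP-x^suc-e ⟩
      toP (fromP {m} ((+ suc m ℤ.- + t) ℤ.+ + 0 , (+ 1 ℤ.- snd-pow e b) ℤ.+ + 0))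
        ≡⟨ cong (λ a → toP (fromP {m} (a , (+ 1 ℤ.- snd-pow e b) ℤ.+ + 0))) first-coord ⟩
      toP (fromP {m} (+ c , (+ 1 ℤ.- snd-pow e b) ℤ.+ + 0))
        ≡⟨ toP-fromP-interior _ 0<c c<j ⟩
      (+ c , (+ 1 ℤ.- snd-pow e b) ℤ.+ + 0) ∎
      where
      open ≡-Reasoning
      first-coord : (+ suc m ℤ.- + t) ℤ.+ + 0 ≡ + c
      first-coord = trans (ℤP.+-identityʳ _)
        (trans (cong (λ k → + k ℤ.- + t) j≡c+t) (+[m+n]-+n≡+m c t))

    refutes : ¬ All (HoldsAt L ρ) (QI.premises (coatom-qi e))
    refutes premises@(premise₁ ∷ _) = coatom-snd-absurd e b (cong proj₂ (begin
      (+ c , (+ 1 ℤ.- snd-pow e b) ℤ.+ + 0)  ≡⟨ toP-x^suc-e→bot ⟨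
      toP (imp L (X e) (bot 0))              ≡⟨ cong (toP ∘ imp L (X e)) (x^suc-[1+e]≡bot premises) ⟨
      toP (imp L (X e) (X (suc e)))          ≡⟨ cong toP premise₁ ⟩
      toP (ρ 0)                              ≡⟨ toP-x ⟩
      (+ c , b)                              ∎))
      where open ≡-Reasoning

  A⊨coatom-qi : A ⊨ coatom-qi e
  A⊨coatom-qi ρ premises with Ł-coatom-qi-premises e (π ∘ ρ) (All-HoldsAt-hom π-hom ρ premises)
  ... | inj₁ πx≡d   = proj₁-injective (coatom-qi-holds-at-top e (proj₁ ∘ ρ)
    (trans (coord₁≡t*π (ρ 0) πx≡d) (sym j≡t*d)) (All-HoldsAt-hom ⊆-hom ρ premises))
  ... | inj₂ πx≡1+e = ⊥-elim (Interior.refutes (proj₁ ∘ ρ)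
    (coord₁≡t*π (ρ 0) πx≡1+e) (All-HoldsAt-hom ⊆-hom ρ premises))

¬Primitive-𝒬 : ∀ {I J} e {i j} → i ∈ I → j ∈ J → 2 + e ∣ i → 2 + e ∣ j → 0 ≢ i → 0 ≢ j →
  ¬ Primitive (𝒬 I J)
¬Primitive-𝒬 e {j = zero} _ _ _ _ _ 0≢0 = ⊥-elim (0≢0 refl)
¬Primitive-𝒬 e {j = suc m} _ _ _ (divides zero ()) _ _
¬Primitive-𝒬 {I} {J} e {j = suc m} i∈I j∈J d∣i (divides t@(suc _) j≡t*d) i≢0 _ prim =
  Ł-refutes-coatom-qi e
    (Primitive⇒⊨-preserved (ValidInGens I J) prim (coatom-qi e)
      (A-∈-𝒬 j∈J) A⊨coatom-qi (Hom.toSurjHom π-hom π-surjective) (Ł-∈-𝒬 i∈I d∣i i≢0))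
  where open Multiples m e t j≡t*d

proposition4p13 : (I J : List ℕ) → ReducedPresentation I J →
    CommonDivisorsProper I J → ¬ Primitive (𝒬 I J)
proposition4p13 I J (I≢0 , _) (_ , zero , _ , (i , i∈I , 0∣i) , _) =
  ⊥-elim (I≢0 i i∈I (sym (0∣⇒≡0 0∣i)))
proposition4p13 I J _ (_ , suc zero , d≢1 , _) = ⊥-elim (d≢1 refl)
proposition4p13 I J (I≢0 , J≢0 , _) (_ , suc (suc e) , _ , (i , i∈I , d∣i) , (j , j∈J , d∣j)) =
  ¬Primitive-𝒬 e i∈I j∈J d∣i d∣j (I≢0 i i∈I) (J≢0 j j∈J)
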